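{- For every integer $n\ge 2^{24}\cdot5^3$, the interval $[5n/3,\,37n/19)$ contains an integer of the form $2^a\cdot5^b$ with $a\ge1$ and $b\ge0$. -}

module Defs where

module Submission where

-- Call m = 2^a·5^b (a ≥ 1) good for n when 5n ≤ 3m and 19m < 37n,
-- i.e. m ∈ [5n/3, 37n/19).  The window has ratio 111/95 > 1, so it suffices to
-- exhibit a ladder of numbers 2^a·5^b, each less than 111/95 times its
-- predecessor, whose top rung is exactly twice its bottom rung: scaling the
-- ladder by 2^j covers every dyadic block [2^j·c, 2^(j+1)·c).  The fourteen
-- rungs below go from 2·5^12 to 2^2·5^12, each obtained from the previous
-- one by a factor 2^7/5^3 ≈ 1.024 or 5^10/2^23 ≈ 1.164, both below 111/95 ≈ 1.168.
--
-- The theorem places 5n in a dyadic block of 3·(bottom rung),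
-- brackets it in the scaled ladder and reads off the exponents.

open import Defs
open import Data.Nat using (ℕ; _+_; _*_; _^_; _≤_; _<_)
open import Data.Product using (∃-syntax; _×_)
open import Data.Nat.Base using (zero; suc; z≤n; s≤s; NonZero)
open import Data.Nat.Properties
open import Data.Nat.Solver using (module +-*-Solver)
open import Data.Product using (_,_; proj₁)
open import Data.List.Base using (List; []; _∷_; _∷ʳ_)
open import Data.List.Relation.Unary.Linked using (Linked; [-]; _∷_; linked?)
open import Relation.Binary.Definitions using (Decidable)
open import Relation.Nullary using (yes; no; contradiction)
open import Relation.Nullary.Decidable using (from-yes; _×-dec_)
open import Relation.Binary.PropositionalEquality using (_≡_; refl; sym; trans; cong; subst)

Rung : Set
Rung = ℕ × ℕ

value : Rung → ℕ
value (a , b) = 2 ^ a * 5 ^ b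

-- The admissible step from rung p to rung q: q has a positive power of 2 and
-- value q < (111/95)·value p, 111/95 being the ratio of the window ends.
Step : Rung → Rung → Set
Step p q = 1 ≤ proj₁ q × 95 * value q < 111 * value p

step? : Decidable Step
step? p q = (1 ≤? proj₁ q) ×-dec (95 * value q <? 111 * value p)

bottom top : Rung
bottom = 1 , 12
top = 2 , 12

middle : List Rung
middle = (8 , 9) ∷ (15 , 6) ∷ (22 , 3) ∷ (29 , 0) ∷ (6 , 10) ∷ (13 , 7)
       ∷ (20 , 4) ∷ (27 , 1) ∷ (4 , 11) ∷ (11 , 8) ∷ (18 , 5) ∷ (25 , 2) ∷ []

ladder-steps : Linked Step (bottom ∷ middle ∷ʳ top)
ladder-steps = from-yes (linked? step? (bottom ∷ middle ∷ʳ top))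

ladder-doubles : 3 * value top ≡ 2 * (3 * value bottom)
ladder-doubles = refl

bracket : ∀ {A : Set} {R : A → A → Set} (g : A → ℕ) {p t : A} (ps : List A) →
          Linked R (p ∷ ps ∷ʳ t) → ∀ {y} → g p ≤ y → y ≤ g t →
          ∃[ q ] ∃[ r ] (R q r × g q ≤ y × y ≤ g r)
bracket g []       (Rpt ∷ [-])  lo hi = _ , _ , Rpt , lo , hi
bracket g (q ∷ qs) (Rpq ∷ Rrest) {y} lo hi with y ≤? g q
... | yes y≤q = _ , _ , Rpq , lo , y≤q
... | no  y≰q = bracket g qs Rrest (<⇒≤ (≰⇒> y≰q)) hi

n<2^n : ∀ n → n < 2 ^ n
n<2^n zero    = s≤s z≤n
n<2^n (suc n) = begin-strict
  suc n         ≤⟨ n<2^n n ⟩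
  2 ^ n         <⟨ m<m+n (2 ^ n) (m^n>0 2 n) ⟩
  2 ^ n + 2 ^ n ≡⟨ cong (2 ^ n +_) (sym (+-identityʳ (2 ^ n))) ⟩
  2 ^ suc n     ∎
  where open ≤-Reasoning

-- Any x ≥ K lies in a dyadic block [2^j·K, 2^j·2K).  Searching downwards from
-- an exponent t with x < 2^t·K, the first t that fails gives the block.
dyadic-below : ∀ K x t → K ≤ x → x < 2 ^ t * K → ∃[ j ] (2 ^ j * K ≤ x × x < 2 ^ j * (2 * K))
dyadic-below K x zero    K≤x x<K = contradiction x<K (≤⇒≯ (subst (_≤ x) (sym (+-identityʳ K)) K≤x))
dyadic-below K x (suc t) K≤x x<2^[1+t]K with x <? 2 ^ t * K
... | yes x<2^tK = dyadic-below K x t K≤x x<2^tK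
... | no  x≮2^tK = t , ≮⇒≥ x≮2^tK , subst (x <_) (doubling (2 ^ t) K) x<2^[1+t]K
  where open +-*-Solver
        doubling : ∀ P K → 2 * P * K ≡ P * (2 * K)
        doubling = solve 2 (λ P K → con 2 :* P :* K := P :* (con 2 :* K)) refl

-- A starting exponent for the search is t = x, since x < 2^x ≤ 2^x·K.
dyadic : ∀ K .{{_ : NonZero K}} x → K ≤ x → ∃[ j ] (2 ^ j * K ≤ x × x < 2 ^ j * (2 * K))
dyadic K x K≤x = dyadic-below K x x K≤x (<-≤-trans (n<2^n x) (m≤m*n (2 ^ x) K))

scaled-in-window : ∀ s .{{_ : NonZero s}} u v n → 95 * v < 111 * u →
                   s * (3 * u) ≤ 5 * n → 5 * n ≤ s * (3 * v) →
                   5 * n ≤ 3 * (s * v) × 19 * (s * v) < 37 * n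
scaled-in-window s u v n ratio lo hi =
  subst (5 * n ≤_) (move-3 s v) hi , *-cancelˡ-< 5 _ _ upper
  where
  open +-*-Solver
  move-3 : ∀ s v → s * (3 * v) ≡ 3 * (s * v)
  move-3 = solve 2 (λ s v → s :* (con 3 :* v) := con 3 :* (s :* v)) refl
  upper : 5 * (19 * (s * v)) < 5 * (37 * n)
  upper = begin-strict
    5 * (19 * (s * v))   ≡⟨ solve 2 (λ s v → con 5 :* (con 19 :* (s :* v)) := s :* (con 95 :* v)) refl s v ⟩
    s * (95 * v)         <⟨ *-monoʳ-< s ratio ⟩
    s * (111 * u)        ≡⟨ solve 2 (λ s u → s :* (con 111 :* u) := con 37 :* (s :* (con 3 :* u))) refl s u ⟩
    37 * (s * (3 * u))   ≤⟨ *-monoʳ-≤ 37 lo ⟩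
    37 * (5 * n)         ≡⟨ solve 1 (λ n → con 37 :* (con 5 :* n) := con 5 :* (con 37 :* n)) refl n ⟩
    5 * (37 * n)         ∎
    where open ≤-Reasoning

Witnessed : ℕ → Set
Witnessed n = ∃[ a ] ∃[ b ] (1 ≤ a × 5 * n ≤ 3 * (2 ^ a * 5 ^ b) × 19 * (2 ^ a * 5 ^ b) < 37 * n)

scaled : ℕ → Rung → ℕ
scaled j r = 2 ^ j * (3 * value r)

good-rung : ∀ n j → ∃[ p ] ∃[ q ] (Step p q × scaled j p ≤ 5 * n × 5 * n ≤ scaled j q) →
            Witnessed n
good-rung n j (p , (a , b) , (1≤a , ratio) , lo , hi) =
  j + a , b , ≤-trans 1≤a (m≤n+m a j) ,
  subst (λ m → 5 * n ≤ 3 * m × 19 * m < 37 * n) (sym shift)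
        (scaled-in-window (2 ^ j) {{m^n≢0 2 j}} (value p) (value (a , b)) n ratio lo hi)
  where
  shift : 2 ^ (j + a) * 5 ^ b ≡ 2 ^ j * value (a , b)
  shift = trans (cong (_* 5 ^ b) (^-distribˡ-+-* 2 j a)) (*-assoc (2 ^ j) (2 ^ a) (5 ^ b))

bottom≤5n : ∀ n → 2 ^ 24 * 5 ^ 3 ≤ n → 3 * value bottom ≤ 5 * n
bottom≤5n n n≥N = ≤-trans (from-yes (3 * value bottom ≤? 5 * (2 ^ 24 * 5 ^ 3))) (*-monoʳ-≤ 5 n≥N)

lemma10 : ∀ (n : ℕ) → 2 ^ 24 * 5 ^ 3 ≤ n →
    ∃[ a ] ∃[ b ] (1 ≤ a × 5 * n ≤ 3 * (2 ^ a * 5 ^ b) × 19 * (2 ^ a * 5 ^ b) < 37 * n)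
lemma10 n n≥N =
  let (j , lo , hi) = dyadic (3 * value bottom) (5 * n) (bottom≤5n n n≥N)
      hi′ : 5 * n ≤ scaled j top
      hi′ = <⇒≤ (subst (λ c → 5 * n < 2 ^ j * c) (sym ladder-doubles) hi)
  -- the ladder ends are given explicitly so they are not recovered by
  -- unifying against large numerals
  in good-rung n j (bracket (scaled j) {bottom} {top} middle ladder-steps lo hi′)
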